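{- For all $\Delta\geq 42$ there is a triangle-free graph with diameter $3$, maximum degree at most $\Delta$, and at least $\left(2\lfloor\frac{\Delta+6}{12}\rfloor+4\right)^3$ vertices. -}

module Defs where

open import Data.Nat using (ℕ; zero; suc; _≤_)
open import Data.Fin using (Fin)
open import Data.Bool using (Bool; true; false)
open import Data.List using (List; length; filter; allFin)
open import Data.Product using (Σ; ∃; _×_; _,_)
open import Relation.Nullary using (¬_)
open import Data.Empty using (⊥)
open import Relation.Binary.PropositionalEquality using (_≡_)
open import Data.Bool.Properties using (T?)
open import Data.Bool using (T)

record Graph (n : ℕ) : Set where
  field
    adj       : Fin n → Fin n → Bool
    adj-sym   : ∀ u v → adj u v ≡ adj v u
    adj-irrefl : ∀ v → adj v v ≡ false

open Graph public

module _ {n : ℕ} (G : Graph n) where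

  Adj : Fin n → Fin n → Set
  Adj u v = adj G u v ≡ true

  TriangleFree : Set
  TriangleFree = ∀ u v w → Adj u v → Adj v w → Adj u w → ⊥

  degree : Fin n → ℕ
  degree v = length (filter (λ u → T? (adj G v u)) (allFin n))

  MaxDegreeAtMost : ℕ → Set
  MaxDegreeAtMost Δ = ∀ v → degree v ≤ Δ

  data Walk : ℕ → Fin n → Fin n → Set where
    here : ∀ {u} → Walk zero u u
    step : ∀ {k u w v} → Adj u w → Walk k w v → Walk (suc k) u v

  DistAtMost : ℕ → Fin n → Fin n → Set
  DistAtMost k u v = Σ ℕ (λ j → j ≤ k × Walk j u v)

  HasDiameter : ℕ → Set
  HasDiameter zero = ∀ u v → DistAtMost zero u v
  HasDiameter (suc d) =
    (∀ u v → DistAtMost (suc d) u v) × ∃ (λ u → ∃ (λ v → ¬ DistAtMost d u v))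

-- Vertices are triples over a finite set with a fixed-point-free involution σ (halves of Fin (2h)
-- swapped).  Coordinatewise a pair of points is the same, antipodal (b = σ a) or far, and two triples
-- are adjacent when their classes read (far, anti, same), (same, far, anti), (anti, same, far) or
-- (anti, anti, anti); a vertex has at most 3 · 2h + 1 neighbours.  How the class of (a, c) depends on
-- the classes of (a, b) and (b, c) is a small table, and it shows that the pattern of a two-step walk
-- is never an edge pattern (no triangles) nor (anti, anti, same) (diameter at least 3).  Conversely,
-- once h ≥ 3 any two points have a common far point, which lets every pattern be realised by a walk of
-- length at most 3.  With 2h = 2⌊(Δ+6)/12⌋ + 4 the degree bound 6h + 1 is at most Δ.
module Submission where

open import Defs
open import Data.Bool using (Bool; true; false; T; _∨_)
open import Data.Bool.Properties using (T?; T-≡; T-∨)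
open import Data.Empty using (⊥; ⊥-elim)
open import Data.Fin as Fin using (Fin; splitAt; join; combine; remQuot)
open import Data.Fin.Patterns using (0F; 1F; 2F)
open import Data.Fin.Properties using (splitAt-join; join-splitAt; remQuot-combine; combine-remQuot)
open import Data.List using (List; []; _∷_; [_]; length; map; _++_; filter; allFin)
open import Data.List.Properties using (length-map; length-++; length-tabulate; length-removeAt′)
open import Data.List.Membership.Propositional using (_∈_)
open import Data.List.Membership.Propositional.Properties using (∈-map⁺; ∈-++⁺ˡ; ∈-++⁺ʳ; ∈-filter⁻; ∈-allFin)
open import Data.List.Relation.Binary.Subset.Propositional using (_⊆_)
open import Data.List.Relation.Unary.Any as Any using (here; there)
import Data.List.Relation.Unary.All as All
open import Data.List.Relation.Unary.AllPairs using (_∷_)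
open import Data.List.Relation.Unary.Unique.Propositional using (Unique)
open import Data.List.Relation.Unary.Unique.Propositional.Properties using (allFin⁺; filter⁺)
open import Data.Nat using (ℕ; suc; _≤_; _+_; _*_; _^_; _/_; _≤ᵇ_; z≤n; s≤s)
open import Data.Nat.Properties
open import Data.Nat.DivMod using (m/n*n≤m; /-monoˡ-≤)
open import Data.Nat.Tactic.RingSolver using (solve-∀)
open import Data.Product using (Σ; _×_; _,_; proj₁; proj₂; map₂)
open import Data.Sum using (_⊎_; inj₁; inj₂; swap)
open import Data.Sum.Properties using (swap-involutive)
open import Function using (_∘_; Equivalence)
open import Relation.Binary.Definitions using (DecidableEquality)
open import Relation.Nullary using (¬_; Dec; yes; no)
open import Relation.Nullary.Decidable using (⌊_⌋; toWitness; fromWitness)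
open import Relation.Binary.PropositionalEquality hiding ([_])

module _ {A : Set} where

  ∈-─ : ∀ {x z : A} {ys} (x∈ys : x ∈ ys) → z ∈ ys → x ≢ z → z ∈ (ys Any.─ x∈ys)
  ∈-─ (here refl) (here refl) x≢z = ⊥-elim (x≢z refl)
  ∈-─ (here refl) (there z∈ys) _ = z∈ys
  ∈-─ (there _) (here refl) _ = here refl
  ∈-─ (there x∈ys) (there z∈ys) x≢z = there (∈-─ x∈ys z∈ys x≢z)

  Unique-⊆⇒length-≤ : ∀ {xs ys : List A} → Unique xs → xs ⊆ ys → length xs ≤ length ys
  Unique-⊆⇒length-≤ {[]} _ _ = z≤n
  Unique-⊆⇒length-≤ {x ∷ xs} {ys} (x∉xs ∷ unique) xs⊆ys = begin
    suc (length xs)              ≤⟨ s≤s (Unique-⊆⇒length-≤ unique xs⊆ys─x) ⟩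
    suc (length (ys Any.─ x∈ys)) ≡⟨ length-removeAt′ ys (Any.index x∈ys) ⟨
    length ys                    ∎
    where
    open ≤-Reasoning
    x∈ys : x ∈ ys
    x∈ys = xs⊆ys (here refl)
    xs⊆ys─x : xs ⊆ (ys Any.─ x∈ys)
    xs⊆ys─x z∈xs = ∈-─ x∈ys (xs⊆ys (there z∈xs)) (All.lookup x∉xs z∈xs)

data Class : Set where
  same anti far : Class

toggle : Class → Class
toggle same = anti
toggle anti = same
toggle far  = far

far? : (t : Class) → Dec (t ≡ far)
far? same = no λ ()
far? anti = no λ ()
far? far  = yes refl

-- Composite x y w: w is a possible class of (a, c) when (a, b) has class x and (b, c) class y.
data Composite : Class → Class → Class → Set where
  same∘    : ∀ {y} → Composite same y y
  anti∘    : ∀ {y} → Composite anti y (toggle y)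
  far∘same : Composite far same far
  far∘anti : Composite far anti far
  far∘far  : ∀ {w} → Composite far far w

composite-near : ∀ {x y w} → x ≢ far → y ≢ far → Composite x y w → w ≢ far
composite-near _ y≢far same∘ = y≢far
composite-near _ _ (anti∘ {same}) = λ ()
composite-near _ _ (anti∘ {anti}) = λ ()
composite-near _ y≢far (anti∘ {far}) = y≢far
composite-near x≢far _ far∘same = ⊥-elim (x≢far refl)
composite-near x≢far _ far∘anti = ⊥-elim (x≢far refl)
composite-near x≢far _ far∘far = ⊥-elim (x≢far refl)

data Edge : Class → Class → Class → Set where
  far-anti-same  : Edge far anti same
  same-far-anti  : Edge same far anti
  anti-same-far  : Edge anti same far
  anti-anti-anti : Edge anti anti anti

edge? : ∀ x y z → Dec (Edge x y z)
edge? same same _    = no λ ()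
edge? same far  same = no λ ()
edge? same far  anti = yes same-far-anti
edge? same far  far  = no λ ()
edge? same anti _    = no λ ()
edge? anti same same = no λ ()
edge? anti same anti = no λ ()
edge? anti same far  = yes anti-same-far
edge? anti anti same = no λ ()
edge? anti anti anti = yes anti-anti-anti
edge? anti anti far  = no λ ()
edge? anti far  _    = no λ ()
edge? far  same _    = no λ ()
edge? far  anti same = yes far-anti-same
edge? far  anti anti = no λ ()
edge? far  anti far  = no λ ()
edge? far  far  _    = no λ ()

edge-not-antipodal : ∀ {x y z} → Edge x y z → (x , y , z) ≢ (anti , anti , same)
edge-not-antipodal () refl

two-step-avoids : ∀ {x₁ y₁ z₁ x₂ y₂ z₂ x₃ y₃ z₃} → Edge x₁ y₁ z₁ → Edge x₂ y₂ z₂ →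
                  Composite x₁ x₂ x₃ → Composite y₁ y₂ y₃ → Composite z₁ z₂ z₃ →
                  ¬ Edge x₃ y₃ z₃ × (x₃ , y₃ , z₃) ≢ (anti , anti , same)
two-step-avoids far-anti-same  far-anti-same  far∘far  anti∘    same∘    = (λ ()) , (λ ())
two-step-avoids far-anti-same  same-far-anti  far∘same anti∘    same∘    = (λ ()) , (λ ())
two-step-avoids far-anti-same  anti-same-far  far∘anti anti∘    same∘    = (λ ()) , (λ ())
two-step-avoids far-anti-same  anti-anti-anti far∘anti anti∘    same∘    = (λ ()) , (λ ())
two-step-avoids same-far-anti  far-anti-same  same∘    far∘anti anti∘    = (λ ()) , (λ ())
two-step-avoids same-far-anti  same-far-anti  same∘    far∘far  anti∘    = (λ ()) , (λ ())
two-step-avoids same-far-anti  anti-same-far  same∘    far∘same anti∘    = (λ ()) , (λ ())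
two-step-avoids same-far-anti  anti-anti-anti same∘    far∘anti anti∘    = (λ ()) , (λ ())
two-step-avoids anti-same-far  far-anti-same  anti∘    same∘    far∘same = (λ ()) , (λ ())
two-step-avoids anti-same-far  same-far-anti  anti∘    same∘    far∘anti = (λ ()) , (λ ())
two-step-avoids anti-same-far  anti-same-far  anti∘    same∘    far∘far  = (λ ()) , (λ ())
two-step-avoids anti-same-far  anti-anti-anti anti∘    same∘    far∘anti = (λ ()) , (λ ())
two-step-avoids anti-anti-anti far-anti-same  anti∘    anti∘    anti∘    = (λ ()) , (λ ())
two-step-avoids anti-anti-anti same-far-anti  anti∘    anti∘    anti∘    = (λ ()) , (λ ())
two-step-avoids anti-anti-anti anti-same-far  anti∘    anti∘    anti∘    = (λ ()) , (λ ())
two-step-avoids anti-anti-anti anti-anti-anti anti∘    anti∘    anti∘    = (λ ()) , (λ ())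

-- T (feasible xs t): points of class t are joined by a path whose steps have classes xs, provided
-- any two points have a common far point (see realize).
feasible : List Class → Class → Bool
feasible []          same = true
feasible []          _    = false
feasible (same ∷ xs) t    = feasible xs t
feasible (anti ∷ xs) t    = feasible xs (toggle t)
feasible (far ∷ xs)  far  = feasible xs same ∨ feasible xs anti ∨ feasible xs far
feasible (far ∷ xs)  _    = feasible xs far

feasible-[]⁻ : ∀ {t} → T (feasible [] t) → t ≡ same
feasible-[]⁻ {same} _ = refl

data Route : List Class → List Class → List Class → Set where
  []  : Route [] [] []
  _∷_ : ∀ {x y z xs ys zs} → Edge x y z → Route xs ys zs → Route (x ∷ xs) (y ∷ ys) (z ∷ zs)

-- On closed routes the hidden fields reduce to ⊤ and are filled by η, so each entry of the table
-- below is checked by evaluation.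
record ShortRoute (x y z : Class) : Set where
  constructor route
  field
    {xs ys zs}  : List Class
    edges       : Route xs ys zs
    {short}     : T (length xs ≤ᵇ 3)
    {feasible₁} : T (feasible xs x)
    {feasible₂} : T (feasible ys y)
    {feasible₃} : T (feasible zs z)

shortRoute : ∀ x y z → ShortRoute x y z
shortRoute same same same = route ([])
shortRoute same same anti = route (anti-same-far ∷ anti-same-far ∷ [])
shortRoute same same far  = route (anti-same-far ∷ anti-same-far ∷ [])
shortRoute same anti same = route (same-far-anti ∷ same-far-anti ∷ [])
shortRoute same anti anti = route (far-anti-same ∷ far-anti-same ∷ anti-anti-anti ∷ [])
shortRoute same anti far  = route (anti-same-far ∷ anti-anti-anti ∷ [])
shortRoute same far  same = route (same-far-anti ∷ same-far-anti ∷ [])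
shortRoute same far  anti = route (same-far-anti ∷ [])
shortRoute same far  far  = route (same-far-anti ∷ anti-same-far ∷ anti-same-far ∷ [])
shortRoute anti same same = route (far-anti-same ∷ far-anti-same ∷ [])
shortRoute anti same anti = route (same-far-anti ∷ same-far-anti ∷ anti-anti-anti ∷ [])
shortRoute anti same far  = route (anti-same-far ∷ [])
shortRoute anti anti same = route (far-anti-same ∷ far-anti-same ∷ far-anti-same ∷ [])
shortRoute anti anti anti = route (anti-anti-anti ∷ [])
shortRoute anti anti far  = route (same-far-anti ∷ same-far-anti ∷ anti-same-far ∷ [])
shortRoute anti far  same = route (same-far-anti ∷ anti-anti-anti ∷ [])
shortRoute anti far  anti = route (far-anti-same ∷ far-anti-same ∷ same-far-anti ∷ [])
shortRoute anti far  far  = route (same-far-anti ∷ anti-same-far ∷ [])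
shortRoute far  same same = route (far-anti-same ∷ far-anti-same ∷ [])
shortRoute far  same anti = route (far-anti-same ∷ anti-anti-anti ∷ [])
shortRoute far  same far  = route (far-anti-same ∷ far-anti-same ∷ anti-same-far ∷ [])
shortRoute far  anti same = route (far-anti-same ∷ [])
shortRoute far  anti anti = route (far-anti-same ∷ far-anti-same ∷ anti-anti-anti ∷ [])
shortRoute far  anti far  = route (far-anti-same ∷ anti-same-far ∷ [])
shortRoute far  far  same = route (far-anti-same ∷ same-far-anti ∷ same-far-anti ∷ [])
shortRoute far  far  anti = route (far-anti-same ∷ same-far-anti ∷ [])
shortRoute far  far  far  = route (far-anti-same ∷ same-far-anti ∷ anti-same-far ∷ [])

module Antipodal {P : Set} (_≟_ : DecidableEquality P) (σ : P → P)
                 (σ-involutive : ∀ a → σ (σ a) ≡ a) (σ-moves : ∀ a → σ a ≢ a) where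

  σ-injective : ∀ {a b} → σ a ≡ σ b → a ≡ b
  σ-injective {a} {b} σa≡σb = begin
    a         ≡⟨ σ-involutive a ⟨
    σ (σ a)   ≡⟨ cong σ σa≡σb ⟩
    σ (σ b)   ≡⟨ σ-involutive b ⟩
    b         ∎
    where open ≡-Reasoning

  σ-flip : ∀ {a b} → a ≡ σ b → b ≡ σ a
  σ-flip {a} {b} a≡σb = trans (sym (σ-involutive b)) (cong σ (sym a≡σb))

  class : P → P → Class
  class a b with a ≟ b
  ... | yes _ = same
  ... | no _ with b ≟ σ a
  ...   | yes _ = anti
  ...   | no _  = far

  data ClassView (a b : P) : Class → Set where
    is-same : a ≡ b → ClassView a b same
    is-anti : b ≡ σ a → ClassView a b anti
    is-far  : a ≢ b → b ≢ σ a → ClassView a b far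

  view : ∀ a b → ClassView a b (class a b)
  view a b with a ≟ b
  ... | yes a≡b = is-same a≡b
  ... | no a≢b with b ≟ σ a
  ...   | yes b≡σa = is-anti b≡σa
  ...   | no b≢σa  = is-far a≢b b≢σa

  view-unique : ∀ {a b t t′} → ClassView a b t → ClassView a b t′ → t ≡ t′
  view-unique (is-same _)     (is-same _)       = refl
  view-unique (is-same refl)  (is-anti b≡σa)    = ⊥-elim (σ-moves _ (sym b≡σa))
  view-unique (is-same a≡b)   (is-far a≢b _)    = ⊥-elim (a≢b a≡b)
  view-unique (is-anti b≡σa)  (is-same refl)    = ⊥-elim (σ-moves _ (sym b≡σa))
  view-unique (is-anti _)     (is-anti _)       = refl
  view-unique (is-anti b≡σa)  (is-far _ b≢σa)   = ⊥-elim (b≢σa b≡σa)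
  view-unique (is-far a≢b _)  (is-same a≡b)     = ⊥-elim (a≢b a≡b)
  view-unique (is-far _ b≢σa) (is-anti b≡σa)    = ⊥-elim (b≢σa b≡σa)
  view-unique (is-far _ _)    (is-far _ _)      = refl

  class-≡ : ∀ {a b t} → ClassView a b t → class a b ≡ t
  class-≡ {a} {b} = view-unique (view a b)

  class⁻ : ∀ {a b t} → class a b ≡ t → ClassView a b t
  class⁻ {a} {b} refl = view a b

  class-same⁻ : ∀ {a b} → class a b ≡ same → a ≡ b
  class-same⁻ eq with class⁻ eq
  ... | is-same a≡b = a≡b

  class-anti⁻ : ∀ {a b} → class a b ≡ anti → b ≡ σ a
  class-anti⁻ eq with class⁻ eq
  ... | is-anti b≡σa = b≡σa

  class-refl : ∀ a → class a a ≡ same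
  class-refl a = class-≡ (is-same refl)

  class-σ : ∀ a → class a (σ a) ≡ anti
  class-σ a = class-≡ (is-anti refl)

  class-sym : ∀ a b → class a b ≡ class b a
  class-sym a b with class a b | view a b
  ... | same | is-same refl = sym (class-refl a)
  ... | anti | is-anti refl = sym (class-≡ (is-anti (sym (σ-involutive a))))
  ... | far  | is-far a≢b b≢σa =
    sym (class-≡ (is-far (a≢b ∘ sym) (b≢σa ∘ σ-flip)))

  class-σˡ : ∀ a b → class (σ a) b ≡ toggle (class a b)
  class-σˡ a b with class a b | view a b
  ... | same | is-same refl = class-≡ (is-anti (sym (σ-involutive a)))
  ... | anti | is-anti refl = class-refl (σ a)
  ... | far  | is-far a≢b b≢σa =
    class-≡ (is-far (b≢σa ∘ sym) (λ b≡σσa → a≢b (trans (sym (σ-involutive a)) (sym b≡σσa))))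

  class-far-σʳ : ∀ {a b} → class a b ≡ far → class a (σ b) ≡ far
  class-far-σʳ {a} {b} eq with class⁻ eq
  ... | is-far a≢b b≢σa =
    class-≡ (is-far (b≢σa ∘ σ-flip) (a≢b ∘ sym ∘ σ-injective))

  class-compose : ∀ a b c → Composite (class a b) (class b c) (class a c)
  class-compose a b c with class a b | view a b
  ... | same | is-same refl = same∘
  ... | anti | is-anti refl = subst (Composite anti (class (σ a) c)) toggle-σ anti∘
    where
    toggle-σ : toggle (class (σ a) c) ≡ class a c
    toggle-σ = trans (sym (class-σˡ (σ a) c)) (cong (λ x → class x c) (σ-involutive a))
  ... | far  | is-far a≢b b≢σa with class b c | view b c
  ...   | same | is-same refl = subst (Composite far same) (sym ab) far∘same
    where ab = class-≡ (is-far a≢b b≢σa)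
  ...   | anti | is-anti refl = subst (Composite far anti) (sym (class-far-σʳ ab)) far∘anti
    where ab = class-≡ (is-far a≢b b≢σa)
  ...   | far  | _            = far∘far

  Spacious : Set
  Spacious = ∀ a b → Σ P λ c → class a c ≡ far × class c b ≡ far

  Near : P → P → Set
  Near a b = class a b ≢ far

  near-sym : ∀ {a b} → Near a b → Near b a
  near-sym {a} {b} ab = ab ∘ trans (class-sym a b)

  near-trans : ∀ {a b c} → Near a b → Near b c → Near a c
  near-trans {a} {b} {c} ab bc = composite-near ab bc (class-compose a b c)

  far-from-both-or-near : ∀ a b c → (class a c ≡ far × class c b ≡ far) ⊎ (Near a c ⊎ Near c b)
  far-from-both-or-near a b c with far? (class a c) | far? (class c b)
  ... | yes ac | yes cb = inj₁ (ac , cb)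
  ... | no ac  | _      = inj₂ (inj₁ ac)
  ... | yes _  | no cb  = inj₂ (inj₂ cb)

  -- Points near a common point are near each other, so of three mutually far points at most one
  -- is near a and at most one is near b.
  three-orbits⇒spacious : ∀ c₀ c₁ c₂ → class c₀ c₁ ≡ far → class c₀ c₂ ≡ far → class c₁ c₂ ≡ far →
                          Spacious
  three-orbits⇒spacious c₀ c₁ c₂ c₀c₁ c₀c₂ c₁c₂ a b
    with far-from-both-or-near a b c₀ | far-from-both-or-near a b c₁ | far-from-both-or-near a b c₂
  ... | inj₁ good | _ | _ = c₀ , good
  ... | _ | inj₁ good | _ = c₁ , good
  ... | _ | _ | inj₁ good = c₂ , good
  ... | inj₂ near₀ | inj₂ near₁ | inj₂ near₂ = ⊥-elim (pigeonhole near₀ near₁ near₂)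
    where
    near-a : ∀ {c d} → Near a c → Near a d → Near c d
    near-a ac ad = near-trans (near-sym ac) ad
    near-b : ∀ {c d} → Near c b → Near d b → Near c d
    near-b cb db = near-trans cb (near-sym db)
    pigeonhole : Near a c₀ ⊎ Near c₀ b → Near a c₁ ⊎ Near c₁ b → Near a c₂ ⊎ Near c₂ b → ⊥
    pigeonhole (inj₁ n₀) (inj₁ n₁) _ = near-a n₀ n₁ c₀c₁
    pigeonhole (inj₂ n₀) (inj₂ n₁) _ = near-b n₀ n₁ c₀c₁
    pigeonhole (inj₁ n₀) _ (inj₁ n₂) = near-a n₀ n₂ c₀c₂
    pigeonhole (inj₂ n₀) _ (inj₂ n₂) = near-b n₀ n₂ c₀c₂
    pigeonhole _ (inj₁ n₁) (inj₁ n₂) = near-a n₁ n₂ c₁c₂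
    pigeonhole _ (inj₂ n₁) (inj₂ n₂) = near-b n₁ n₂ c₁c₂

  Path : List Class → P → P → Set
  Path []       a b = a ≡ b
  Path (x ∷ xs) a b = Σ P λ c → class a c ≡ x × Path xs c b

  module _ (spacious : Spacious) where

    realize : ∀ xs a b → T (feasible xs (class a b)) → Path xs a b
    via : ∀ {x xs a b s} c → class a c ≡ x → class c b ≡ s → T (feasible xs s) → Path (x ∷ xs) a b
    via-spacious : ∀ {xs} a b → T (feasible xs far) → Path (far ∷ xs) a b

    via {xs = xs} {b = b} c ac cb ok = c , ac , realize xs c b (subst (T ∘ feasible xs) (sym cb) ok)

    via-spacious a b ok = let c , ac , cb = spacious a b in via c ac cb ok

    realize []          a b ok = class-same⁻ (feasible-[]⁻ ok)
    realize (same ∷ xs) a b ok = via a (class-refl a) refl ok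
    realize (anti ∷ xs) a b ok = via (σ a) (class-σ a) (class-σˡ a b) ok
    realize (far ∷ xs)  a b ok with class a b in ab
    ... | same = via-spacious a b ok
    ... | anti = via-spacious a b ok
    ... | far with Equivalence.to T-∨ ok
    ...   | inj₁ ok-same = via b ab (class-refl b) ok-same
    ...   | inj₂ ok′ with Equivalence.to T-∨ ok′
    ...     | inj₁ ok-anti = via (σ b) (class-far-σʳ ab) (trans (class-sym (σ b) b) (class-σ b)) ok-anti
    ...     | inj₂ ok-far  = via-spacious a b ok-far

module Construction {m : ℕ} (σ : Fin m → Fin m)
                    (σ-involutive : ∀ a → σ (σ a) ≡ a) (σ-moves : ∀ a → σ a ≢ a) where

  open Antipodal Fin._≟_ σ σ-involutive σ-moves public

  Vertex : Set
  Vertex = Fin m × Fin m × Fin m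

  N : ℕ
  N = m * (m * m)

  encode : Vertex → Fin N
  encode (a , b , c) = combine a (combine b c)

  decode : Fin N → Vertex
  decode u = map₂ (remQuot m) (remQuot (m * m) u)

  decode-encode : ∀ s → decode (encode s) ≡ s
  decode-encode (a , b , c) =
    trans (cong (map₂ (remQuot m)) (remQuot-combine a (combine b c))) (cong (a ,_) (remQuot-combine b c))

  encode-decode : ∀ u → encode (decode u) ≡ u
  encode-decode u = trans (cong (combine {m} _) (combine-remQuot {m} m _)) (combine-remQuot {m} (m * m) u)

  Adjacent : Vertex → Vertex → Set
  Adjacent (a , b , c) (a′ , b′ , c′) = Edge (class a a′) (class b b′) (class c c′)

  adjacent? : ∀ s t → Dec (Adjacent s t)
  adjacent? (a , b , c) (a′ , b′ , c′) = edge? (class a a′) (class b b′) (class c c′)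

  classes : Vertex → Vertex → Class × Class × Class
  classes (a , b , c) (a′ , b′ , c′) = class a a′ , class b b′ , class c c′

  adjacent-sym : ∀ s t → ⌊ adjacent? s t ⌋ ≡ ⌊ adjacent? t s ⌋
  adjacent-sym (a , b , c) (a′ , b′ , c′)
    rewrite class-sym a a′ | class-sym b b′ | class-sym c c′ = refl

  adjacent-irrefl : ∀ s → ⌊ adjacent? s s ⌋ ≡ false
  adjacent-irrefl (a , b , _) rewrite class-refl a | class-refl b = refl

  G : Graph N
  G = record
    { adj        = λ u v → ⌊ adjacent? (decode u) (decode v) ⌋
    ; adj-sym    = λ u v → adjacent-sym (decode u) (decode v)
    ; adj-irrefl = λ v → adjacent-irrefl (decode v)
    }

  T⇒Adjacent : ∀ {u v} → T (adj G u v) → Adjacent (decode u) (decode v)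
  T⇒Adjacent = toWitness

  Adj⇒Adjacent : ∀ {u v} → Adj G u v → Adjacent (decode u) (decode v)
  Adj⇒Adjacent = toWitness ∘ Equivalence.from T-≡

  Adjacent⇒Adj : ∀ {u v} → Adjacent (decode u) (decode v) → Adj G u v
  Adjacent⇒Adj = Equivalence.to T-≡ ∘ fromWitness

  classes-refl : ∀ s → classes s s ≡ (same , same , same)
  classes-refl (a , b , c) = cong₂ _,_ (class-refl a) (cong₂ _,_ (class-refl b) (class-refl c))

  adjacent-two-step : ∀ s r t → Adjacent s r → Adjacent r t →
                      ¬ Adjacent s t × classes s t ≢ (anti , anti , same)
  adjacent-two-step (a , b , c) (a′ , b′ , c′) (a″ , b″ , c″) sr rt =
    two-step-avoids sr rt (class-compose a a′ a″) (class-compose b b′ b″) (class-compose c c′ c″)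

  triangle-free : TriangleFree G
  triangle-free u v w uv vw uw =
    proj₁ (adjacent-two-step (decode u) (decode v) (decode w) (Adj⇒Adjacent uv) (Adj⇒Adjacent vw))
          (Adj⇒Adjacent uw)

  route-walk : ∀ {xs ys zs a b c a′ b′ c′} → Route xs ys zs → Path xs a a′ → Path ys b b′ → Path zs c c′ →
               Walk G (length xs) (encode (a , b , c)) (encode (a′ , b′ , c′))
  route-walk [] refl refl refl = here
  route-walk (e ∷ es) (a₁ , refl , p) (b₁ , refl , q) (c₁ , refl , r) =
    step (Adjacent⇒Adj (subst₂ Adjacent (sym (decode-encode _)) (sym (decode-encode _)) e))
         (route-walk es p q r)

  within-three : Spacious → ∀ s t → DistAtMost G 3 (encode s) (encode t)
  within-three spacious (a , b , c) (a′ , b′ , c′) =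
    length xs , ≤ᵇ⇒≤ (length xs) 3 short ,
    route-walk edges (realize spacious xs a a′ feasible₁) (realize spacious ys b b′ feasible₂)
                     (realize spacious zs c c′ feasible₃)
    where open ShortRoute (shortRoute (class a a′) (class b b′) (class c c′))

  not-within-two : ∀ u v → classes (decode u) (decode v) ≡ (anti , anti , same) → ¬ DistAtMost G 2 u v
  not-within-two u _ uv (0 , _ , here) with trans (sym (classes-refl (decode u))) uv
  ... | ()
  not-within-two u v uv (1 , _ , step e here) = edge-not-antipodal (Adj⇒Adjacent e) uv
  not-within-two u v uv (2 , _ , step e₁ (step e₂ here)) =
    proj₂ (adjacent-two-step (decode u) _ (decode v) (Adj⇒Adjacent e₁) (Adj⇒Adjacent e₂)) uv
  not-within-two _ _ _ (suc (suc (suc _)) , s≤s (s≤s ()) , _)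

  neighbours : Vertex → List Vertex
  neighbours (a , b , c) =
    map (λ x → x , σ b , c) (allFin m) ++ map (λ y → a , y , σ c) (allFin m) ++
    map (λ z → σ a , b , z) (allFin m) ++ [ σ a , σ b , σ c ]

  length-map-allFin : ∀ {A : Set} (f : Fin m → A) → length (map f (allFin m)) ≡ m
  length-map-allFin f = trans (length-map f (allFin m)) (length-tabulate (λ x → x))

  length-neighbours : ∀ s → length (neighbours s) ≡ m + (m + (m + 1))
  length-neighbours (a , b , c) =
    trans (length-++ xs) (cong₂ _+_ (length-map-allFin _)
      (trans (length-++ ys) (cong₂ _+_ (length-map-allFin _)
        (trans (length-++ zs) (cong (_+ 1) (length-map-allFin _))))))
    where
    xs = map (λ x → x , σ b , c) (allFin m)
    ys = map (λ y → a , y , σ c) (allFin m)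
    zs = map (λ z → σ a , b , z) (allFin m)

  adjacent⇒∈-neighbours : ∀ s t → Adjacent s t → t ∈ neighbours s
  adjacent⇒∈-neighbours (a , b , c) (a′ , b′ , c′) e
    with class a a′ | view a a′ | class b b′ | view b b′ | class c c′ | view c c′ | e
  ... | far  | _            | anti | is-anti refl | same | is-same refl | far-anti-same =
    ∈-++⁺ˡ (∈-map⁺ _ (∈-allFin a′))
  ... | same | is-same refl | far  | _            | anti | is-anti refl | same-far-anti =
    ∈-++⁺ʳ (map _ (allFin m)) (∈-++⁺ˡ (∈-map⁺ _ (∈-allFin b′)))
  ... | anti | is-anti refl | same | is-same refl | far  | _            | anti-same-far =
    ∈-++⁺ʳ (map _ (allFin m)) (∈-++⁺ʳ (map _ (allFin m)) (∈-++⁺ˡ (∈-map⁺ _ (∈-allFin c′))))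
  ... | anti | is-anti refl | anti | is-anti refl | anti | is-anti refl | anti-anti-anti =
    ∈-++⁺ʳ (map _ (allFin m)) (∈-++⁺ʳ (map _ (allFin m)) (∈-++⁺ʳ (map _ (allFin m)) (here refl)))

  degree-≤ : ∀ v → degree G v ≤ m + (m + (m + 1))
  degree-≤ v = begin
    degree G v                     ≤⟨ Unique-⊆⇒length-≤ (filter⁺ adjacent-to-v? (allFin⁺ N)) neighbour⇒listed ⟩
    length (map encode listed)     ≡⟨ length-map encode listed ⟩
    length listed                  ≡⟨ length-neighbours (decode v) ⟩
    m + (m + (m + 1))              ∎
    where
    open ≤-Reasoning
    listed = neighbours (decode v)
    adjacent-to-v? = λ u → T? (adj G v u)
    neighbour⇒listed : filter adjacent-to-v? (allFin N) ⊆ map encode listed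
    neighbour⇒listed {u} u∈ =
      subst (_∈ map encode listed) (encode-decode u)
        (∈-map⁺ encode (adjacent⇒∈-neighbours (decode v) (decode u) (T⇒Adjacent v~u)))
      where
      v~u = proj₂ (∈-filter⁻ adjacent-to-v? {xs = allFin N} u∈)

  diameter-three : Spacious → Fin m → HasDiameter G 3
  diameter-three spacious p =
    (λ u v → subst₂ (DistAtMost G 3) (encode-decode u) (encode-decode v)
                    (within-three spacious (decode u) (decode v))) ,
    encode s , encode t , not-within-two (encode s) (encode t) s-t-antipodal
    where
    s t : Vertex
    s = p , p , p
    t = σ p , σ p , p
    s-t-antipodal : classes (decode (encode s)) (decode (encode t)) ≡ (anti , anti , same)
    s-t-antipodal = trans (cong₂ classes (decode-encode s) (decode-encode t))
                          (cong₂ _,_ (class-σ p) (cong₂ _,_ (class-σ p) (class-refl p)))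

swapHalves : ∀ h → Fin (h + h) → Fin (h + h)
swapHalves h = join h h ∘ swap ∘ splitAt h

swapHalves-involutive : ∀ h i → swapHalves h (swapHalves h i) ≡ i
swapHalves-involutive h i = begin
  join h h (swap (splitAt h (join h h (swap (splitAt h i)))))
    ≡⟨ cong (join h h ∘ swap) (splitAt-join h h (swap (splitAt h i))) ⟩
  join h h (swap (swap (splitAt h i)))
    ≡⟨ cong (join h h) (swap-involutive (splitAt h i)) ⟩
  join h h (splitAt h i)
    ≡⟨ join-splitAt h h i ⟩
  i ∎
  where open ≡-Reasoning

swapHalves-moves : ∀ h i → swapHalves h i ≢ i
swapHalves-moves h i eq = swap-moves (splitAt h i) (trans (sym (splitAt-join h h _)) (cong (splitAt h) eq))
  where
  swap-moves : ∀ {A : Set} (x : A ⊎ A) → swap x ≢ x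
  swap-moves (inj₁ _) ()
  swap-moves (inj₂ _) ()

degree-budget : ∀ {Δ} j → 42 ≤ Δ → suc j * 12 ≤ Δ + 6 →
                let m = 3 + j + (3 + j) in m + (m + (m + 1)) ≤ Δ
degree-budget {Δ} j 42≤Δ 12k≤Δ+6 = *-cancelˡ-≤ 2 (begin
  2 * (m + (m + (m + 1))) ≡⟨ doubled j ⟩
  suc j * 12 + 26         ≤⟨ +-monoˡ-≤ 26 12k≤Δ+6 ⟩
  Δ + 6 + 26              ≡⟨ +-assoc Δ 6 26 ⟩
  Δ + 32                  ≤⟨ +-monoʳ-≤ Δ (≤-trans (≤ᵇ⇒≤ 32 42 _) 42≤Δ) ⟩
  Δ + Δ                   ≡⟨ cong (Δ +_) (+-identityʳ Δ) ⟨
  2 * Δ                   ∎)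
  where
  open ≤-Reasoning
  m = 3 + j + (3 + j)
  doubled : ∀ j → 2 * ((3 + j + (3 + j)) + ((3 + j + (3 + j)) + ((3 + j + (3 + j)) + 1))) ≡ suc j * 12 + 26
  doubled = solve-∀

vertex-count : ∀ j → let m = 3 + j + (3 + j) in (2 * suc j + 4) ^ 3 ≡ m * (m * m)
vertex-count j = trans (cong (_^ 3) (halves j)) (cong (λ x → m * (m * x)) (*-identityʳ m))
  where
  m = 3 + j + (3 + j)
  halves : ∀ j → 2 * suc j + 4 ≡ 3 + j + (3 + j)
  halves = solve-∀

large-graph : ∀ Δ k → 42 ≤ Δ → 1 ≤ k → k * 12 ≤ Δ + 6 →
  Σ ℕ (λ n → Σ (Graph n) (λ G →
    TriangleFree G × HasDiameter G 3 × MaxDegreeAtMost G Δ × ((2 * k + 4) ^ 3 ≤ n)))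
large-graph Δ (suc j) 42≤Δ _ 12k≤Δ+6 =
  N , G , triangle-free , diameter-three spacious Fin.zero ,
  (λ v → ≤-trans (degree-≤ v) (degree-budget j 42≤Δ 12k≤Δ+6)) , ≤-reflexive (vertex-count j)
  where
  open Construction (swapHalves (3 + j)) (swapHalves-involutive (3 + j)) (swapHalves-moves (3 + j))
  spacious : Spacious
  spacious = three-orbits⇒spacious 0F 1F 2F
    (class-≡ {0F} {1F} (is-far (λ ()) (λ ())))
    (class-≡ {0F} {2F} (is-far (λ ()) (λ ())))
    (class-≡ {1F} {2F} (is-far (λ ()) (λ ())))

mainTheorem20 : (Δ : ℕ) → 42 ≤ Δ →
    Σ ℕ (λ n → Σ (Graph n) (λ G →
      TriangleFree G × HasDiameter G 3 × MaxDegreeAtMost G Δ ×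
      ((2 * ((Δ + 6) / 12) + 4) ^ 3 ≤ n)))
mainTheorem20 Δ 42≤Δ = large-graph Δ ((Δ + 6) / 12) 42≤Δ 1≤k (m/n*n≤m (Δ + 6) 12)
  where
  1≤k : 1 ≤ (Δ + 6) / 12
  1≤k = /-monoˡ-≤ 12 (≤-trans (≤ᵇ⇒≤ 12 42 _) (≤-trans 42≤Δ (m≤m+n Δ 6)))
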